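{- Let $p$ be an odd prime and $s\ge1$, $k\ge1$ integers. Then $$\rho_{k,0}(p^s)=\Omega\big(k,p,s,\lfloor\tfrac{s-1}{2}\rfloor\big)\cdot(\rho_{k,0}(p)-1)+p^{k\lfloor s/2\rfloor}.$$
   Context: For positive integers $k,n$ and an integer $\mu$, $\rho_{k,\mu}(n)$ is the number of $(x_1,\dots,x_k)\in(\mathbb{Z}/n\mathbb{Z})^k$ with $x_1^2+\cdots+x_k^2\equiv\mu\pmod n$. For integers $k,p,s$ and an integer $N\ge0$, $\Omega(k,p,s,N):=\sum_{i=0}^{N}p^{ki+(s-2i-1)(k-1)}$. -}

module Defs where

open import Data.Nat using (ℕ; zero; suc; _+_; _*_; _∸_; _^_; _%_; NonZero)
open import Data.Nat.Divisibility using (_∣?_)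
open import Data.Fin using (Fin; toℕ)
open import Data.Vec using (Vec; []; _∷_)
open import Data.List using (List; []; _∷_; map; concatMap; filter; length; allFin)
open import Relation.Binary.PropositionalEquality using (_≡_)
open import Relation.Nullary.Decidable using (¬?)

allVecs : (n k : ℕ) → List (Vec (Fin n) k)
allVecs n zero = [] ∷ []
allVecs n (suc k) = concatMap (λ x → map (x ∷_) (allVecs n k)) (allFin n)

sumSq : {n k : ℕ} → Vec (Fin n) k → ℕ
sumSq [] = 0
sumSq (x ∷ xs) = toℕ x * toℕ x + sumSq xs

ρ₀ : (k n : ℕ) → ℕ
ρ₀ k n = length (filter (λ v → n ∣? sumSq v) (allVecs n k))

-- Ω(k,p,s,N) = Σ_{i=0}^{N} p^{k i + (s - 2i - 1)(k - 1)}
-- (exponents are natural numbers here; truncated subtraction is exact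
--  whenever 2N+1 ≤ s and k ≥ 1, which is the case in the corollary)
Ω : (k p s N : ℕ) → ℕ
Ω k p s zero = p ^ ((s ∸ 1) * (k ∸ 1))
Ω k p s (suc N) = Ω k p s N + p ^ (k * suc N + (s ∸ (2 * suc N + 1)) * (k ∸ 1))

-- Split the solutions x ∈ (ℤ/p^s)^k of x₁² + ⋯ + x_k² ≡ 0 into singular ones, all of whose
-- coordinates are divisible by p, and nonsingular ones. A singular solution is x = p w, and
-- p^(t+2) ∣ p² ‖w‖² iff p^t ∣ ‖w‖², so reducing w modulo p^t shows there are p^k ρ(p^t) of them.
-- A nonsingular solution modulo p q (with p ∣ q) is y + q z, where y is a nonsingular solution
-- modulo q, say ‖y‖² = c q, and z ∈ (ℤ/p)^k satisfies the linear congruence c + 2⟨z, y⟩ ≡ 0 (mod p).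
-- As p is odd and y ≢ 0 (mod p), that congruence has exactly p^(k-1) solutions (Hensel's lemma).
-- Hence there are (ρ(p) − 1) p^(t(k−1)) nonsingular solutions modulo p^(t+1), and
-- ρ(p^(t+2)) = (ρ(p) − 1) p^((t+1)(k−1)) + p^k ρ(p^t), which unrolls to the sum Ω.

{-# OPTIONS --safe #-}
module Submission where

open import Defs
open import Data.Nat using (ℕ; _+_; _*_; _∸_; _^_; _/_; _≥_)
open import Data.Nat.Primality using (Prime)
open import Relation.Binary.PropositionalEquality using (_≡_; _≢_)

open import Data.Bool using (Bool; true; false; _∧_; not)
open import Data.Empty using (⊥-elim)
open import Data.Fin using (Fin; toℕ)
open import Data.List using (List; []; _∷_; _++_; map; concatMap; filter; length; allFin; tabulate)
open import Data.List.Properties using (filter-++; length-++; map-tabulate; map-cong)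
open import Data.Nat using (zero; suc; pred; _%_; _<_; _≤_; s≤s; z≤n; NonZero; nonTrivial⇒n>1)
open import Data.Nat.Coprimality using (Coprime; coprime-Bézout)
open import Data.Nat.Divisibility
  using (_∣_; _∣?_; divides; ∣-trans; 1∣_; m∣m*n; n∣m*n; m*n∣⇒n∣; ∣m+n∣m⇒∣n; ∣m∣n⇒∣m+n; ∣⇒≤; *-cancelˡ-∣; *-monoʳ-∣)
open import Data.Nat.DivMod using (m≡m%n+[m/n]*n; m%n<n; m/n≡1+[m∸n]/n)
open import Data.Nat.GCD using (module Bézout)
open import Data.Nat.ListAction using (sum)
open import Data.Nat.Primality using (euclidsLemma; prime⇒irreducible; prime⇒nonZero; prime⇒nonTrivial)
open import Data.Nat.Properties
open import Data.Nat.Solver using (module +-*-Solver)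
open import Data.Product using (∃-syntax; _×_; _,_)
open import Data.Sum using (inj₁; inj₂; [_,_]; [_,_]′)
open import Data.Vec using (Vec; []; _∷_; zipWith) renaming (map to vmap)
open import Function using (_∘_; id)
open import Level using (Level)
open import Relation.Binary.PropositionalEquality using (refl; sym; trans; cong; cong₂; subst; subst₂; _≗_; module ≡-Reasoning)
open import Relation.Nullary using (¬_; Dec; yes; no; does)
open import Relation.Nullary.Negation using (contradiction)
open import Relation.Unary using (Pred; Decidable)
open +-*-Solver using (solve; _:+_; _:*_; _:=_; con)
open ≡-Reasoning

-- Finite sums over ranges [0, n) and boxes [0, n)^k

∑< : ℕ → (ℕ → ℕ) → ℕ
∑< zero    f = 0
∑< (suc n) f = f 0 + ∑< n (f ∘ suc)

infix 5 ∑<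
syntax ∑< n (λ x → e) = ∑[ x < n ] e

∑-cong-< : ∀ n {f g : ℕ → ℕ} → (∀ x → x < n → f x ≡ g x) → ∑< n f ≡ ∑< n g
∑-cong-< zero    f≡g = refl
∑-cong-< (suc n) f≡g = cong₂ _+_ (f≡g 0 (s≤s z≤n)) (∑-cong-< n (λ x x<n → f≡g (suc x) (s≤s x<n)))

∑-cong : ∀ n {f g : ℕ → ℕ} → f ≗ g → ∑< n f ≡ ∑< n g
∑-cong n f≗g = ∑-cong-< n (λ x _ → f≗g x)

∑-const : ∀ n c → ∑[ _ < n ] c ≡ n * c
∑-const zero    c = refl
∑-const (suc n) c = cong (c +_) (∑-const n c)

∑-distrib-+ : ∀ n (f g : ℕ → ℕ) → ∑[ x < n ] (f x + g x) ≡ ∑< n f + ∑< n g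
∑-distrib-+ zero    f g = refl
∑-distrib-+ (suc n) f g = begin
  f 0 + g 0 + (∑[ x < n ] f (suc x) + g (suc x))  ≡⟨ cong (f 0 + g 0 +_) (∑-distrib-+ n (f ∘ suc) (g ∘ suc)) ⟩
  f 0 + g 0 + (∑< n (f ∘ suc) + ∑< n (g ∘ suc))   ≡⟨ +-interchange (f 0) (g 0) _ _ ⟩
  f 0 + ∑< n (f ∘ suc) + (g 0 + ∑< n (g ∘ suc))   ∎
  where
  +-interchange : ∀ a b c d → a + b + (c + d) ≡ a + c + (b + d)
  +-interchange = solve 4 (λ a b c d → a :+ b :+ (c :+ d) := a :+ c :+ (b :+ d)) refl

*-distribˡ-∑ : ∀ n c (f : ℕ → ℕ) → c * ∑< n f ≡ ∑[ x < n ] c * f x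
*-distribˡ-∑ zero    c f = *-zeroʳ c
*-distribˡ-∑ (suc n) c f = trans (*-distribˡ-+ c (f 0) _) (cong (c * f 0 +_) (*-distribˡ-∑ n c (f ∘ suc)))

∑-+ : ∀ m n f → ∑< (m + n) f ≡ ∑< m f + (∑[ x < n ] f (m + x))
∑-+ zero    n f = refl
∑-+ (suc m) n f = trans (cong (f 0 +_) (∑-+ m n (f ∘ suc))) (sym (+-assoc (f 0) _ _))

∑-* : ∀ a b f → ∑< (a * b) f ≡ ∑[ z < a ] ∑[ y < b ] f (z * b + y)
∑-* zero    b f = refl
∑-* (suc a) b f = begin
  ∑< (b + a * b) f                                        ≡⟨ ∑-+ b (a * b) f ⟩
  ∑< b f + (∑[ x < a * b ] f (b + x))                     ≡⟨ cong (∑< b f +_) (∑-* a b (f ∘ (b +_))) ⟩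
  ∑< b f + (∑[ z < a ] ∑[ y < b ] f (b + (z * b + y)))    ≡⟨ cong (∑< b f +_) (∑-cong a (λ z → ∑-cong b (λ y →
                                                               cong f (sym (+-assoc b (z * b) y))))) ⟩
  ∑< b f + (∑[ z < a ] ∑[ y < b ] f (suc z * b + y))      ∎

∑-comm : ∀ m n (h : ℕ → ℕ → ℕ) → ∑[ x < m ] ∑[ y < n ] h x y ≡ ∑[ y < n ] ∑[ x < m ] h x y
∑-comm zero    n h = sym (trans (∑-const n 0) (*-zeroʳ n))
∑-comm (suc m) n h = begin
  ∑< n (h 0) + (∑[ x < m ] ∑[ y < n ] h (suc x) y)  ≡⟨ cong (∑< n (h 0) +_) (∑-comm m n (h ∘ suc)) ⟩
  ∑< n (h 0) + (∑[ y < n ] ∑[ x < m ] h (suc x) y)  ≡⟨ sym (∑-distrib-+ n (h 0) _) ⟩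
  ∑[ y < n ] h 0 y + (∑[ x < m ] h (suc x) y)     ∎

∑ᵛ : ℕ → (k : ℕ) → (Vec ℕ k → ℕ) → ℕ
∑ᵛ n zero    f = f []
∑ᵛ n (suc k) f = ∑[ x < n ] ∑ᵛ n k (f ∘ (x ∷_))

∑ᵛ-cong : ∀ n k {f g : Vec ℕ k → ℕ} → f ≗ g → ∑ᵛ n k f ≡ ∑ᵛ n k g
∑ᵛ-cong n zero    f≗g = f≗g []
∑ᵛ-cong n (suc k) f≗g = ∑-cong n (λ x → ∑ᵛ-cong n k (f≗g ∘ (x ∷_)))

∑ᵛ-const : ∀ n k c → ∑ᵛ n k (λ _ → c) ≡ n ^ k * c
∑ᵛ-const n zero    c = sym (+-identityʳ c)
∑ᵛ-const n (suc k) c = begin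
  ∑[ _ < n ] ∑ᵛ n k (λ _ → c)  ≡⟨ ∑-cong n (λ _ → ∑ᵛ-const n k c) ⟩
  ∑[ _ < n ] n ^ k * c         ≡⟨ ∑-const n _ ⟩
  n * (n ^ k * c)              ≡⟨ sym (*-assoc n _ c) ⟩
  n ^ suc k * c                ∎

∑ᵛ-distrib-+ : ∀ n k (f g : Vec ℕ k → ℕ) → ∑ᵛ n k (λ v → f v + g v) ≡ ∑ᵛ n k f + ∑ᵛ n k g
∑ᵛ-distrib-+ n zero    f g = refl
∑ᵛ-distrib-+ n (suc k) f g =
  trans (∑-cong n (λ x → ∑ᵛ-distrib-+ n k (f ∘ (x ∷_)) (g ∘ (x ∷_)))) (∑-distrib-+ n _ _)

*-distribˡ-∑ᵛ : ∀ n k c (f : Vec ℕ k → ℕ) → c * ∑ᵛ n k f ≡ ∑ᵛ n k (λ v → c * f v)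
*-distribˡ-∑ᵛ n zero    c f = refl
*-distribˡ-∑ᵛ n (suc k) c f =
  trans (*-distribˡ-∑ n c _) (∑-cong n (λ x → *-distribˡ-∑ᵛ n k c (f ∘ (x ∷_))))

*-distribʳ-∑ᵛ : ∀ n k c (f : Vec ℕ k → ℕ) → ∑ᵛ n k f * c ≡ ∑ᵛ n k (λ v → f v * c)
*-distribʳ-∑ᵛ n k c f = begin
  ∑ᵛ n k f * c                ≡⟨ *-comm _ c ⟩
  c * ∑ᵛ n k f                ≡⟨ *-distribˡ-∑ᵛ n k c f ⟩
  ∑ᵛ n k (λ v → c * f v)      ≡⟨ ∑ᵛ-cong n k (λ v → *-comm c (f v)) ⟩
  ∑ᵛ n k (λ v → f v * c)      ∎

∑-∑ᵛ-comm : ∀ n m k (h : ℕ → Vec ℕ k → ℕ) → ∑[ x < n ] ∑ᵛ m k (h x) ≡ ∑ᵛ m k (λ v → ∑[ x < n ] h x v)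
∑-∑ᵛ-comm n m zero    h = refl
∑-∑ᵛ-comm n m (suc k) h =
  trans (∑-comm n m _) (∑-cong m (λ y → ∑-∑ᵛ-comm n m k (λ x v → h x (y ∷ v))))

∑ᵛ-comm : ∀ n m k j (h : Vec ℕ k → Vec ℕ j → ℕ) →
          ∑ᵛ n k (λ u → ∑ᵛ m j (h u)) ≡ ∑ᵛ m j (λ v → ∑ᵛ n k (λ u → h u v))
∑ᵛ-comm n m zero    j h = refl
∑ᵛ-comm n m (suc k) j h =
  trans (∑-cong n (λ x → ∑ᵛ-comm n m k j (h ∘ (x ∷_)))) (∑-∑ᵛ-comm n m j _)

∑ᵛ-1 : ∀ k (f : Vec ℕ k → ℕ) → (∀ x → f x ≡ 1) → ∑ᵛ 1 k f ≡ 1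
∑ᵛ-1 k f f≡1 = begin
  ∑ᵛ 1 k f            ≡⟨ ∑ᵛ-cong 1 k f≡1 ⟩
  ∑ᵛ 1 k (λ _ → 1)    ≡⟨ ∑ᵛ-const 1 k 1 ⟩
  1 ^ k * 1           ≡⟨ *-identityʳ (1 ^ k) ⟩
  1 ^ k               ≡⟨ ^-zeroˡ k ⟩
  1                   ∎

combine : ∀ {k} → ℕ → Vec ℕ k → Vec ℕ k → Vec ℕ k
combine b = zipWith (λ z y → z * b + y)

∑ᵛ-* : ∀ a b k (f : Vec ℕ k → ℕ) → ∑ᵛ (a * b) k f ≡ ∑ᵛ a k (λ z → ∑ᵛ b k (f ∘ combine b z))
∑ᵛ-* a b zero    f = refl
∑ᵛ-* a b (suc k) f = begin
  ∑[ x < a * b ] ∑ᵛ (a * b) k (f ∘ (x ∷_))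
    ≡⟨ ∑-cong (a * b) (λ x → ∑ᵛ-* a b k (f ∘ (x ∷_))) ⟩
  ∑[ x < a * b ] ∑ᵛ a k (λ z → ∑ᵛ b k (λ y → f (x ∷ combine b z y)))
    ≡⟨ ∑-* a b _ ⟩
  ∑[ z₀ < a ] ∑[ y₀ < b ] ∑ᵛ a k (λ z → ∑ᵛ b k (λ y → f ((z₀ * b + y₀) ∷ combine b z y)))
    ≡⟨ ∑-cong a (λ z₀ → ∑-∑ᵛ-comm b a k _) ⟩
  ∑[ z₀ < a ] ∑ᵛ a k (λ z → ∑[ y₀ < b ] ∑ᵛ b k (λ y → f ((z₀ * b + y₀) ∷ combine b z y)))  ∎

∑ᵛ-periodic : ∀ a b k (f : Vec ℕ k → ℕ) → (∀ z y → f (combine b z y) ≡ f y) → ∑ᵛ (a * b) k f ≡ a ^ k * ∑ᵛ b k f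
∑ᵛ-periodic a b k f periodic = begin
  ∑ᵛ (a * b) k f                          ≡⟨ ∑ᵛ-* a b k f ⟩
  ∑ᵛ a k (λ z → ∑ᵛ b k (f ∘ combine b z)) ≡⟨ ∑ᵛ-cong a k (λ z → ∑ᵛ-cong b k (periodic z)) ⟩
  ∑ᵛ a k (λ _ → ∑ᵛ b k f)                 ≡⟨ ∑ᵛ-const a k _ ⟩
  a ^ k * ∑ᵛ b k f                        ∎

-- Counting solutions as a sum

⟦_⟧ : Bool → ℕ
⟦ true  ⟧ = 1
⟦ false ⟧ = 0

⟦∧⟧ : ∀ a b → ⟦ a ∧ b ⟧ ≡ ⟦ a ⟧ * ⟦ b ⟧
⟦∧⟧ true  b = sym (+-identityʳ ⟦ b ⟧)
⟦∧⟧ false b = refl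

⟦not⟧*+⟦⟧* : ∀ b m → m ≡ ⟦ not b ⟧ * m + ⟦ b ⟧ * m
⟦not⟧*+⟦⟧* true  m = sym (+-identityʳ m)
⟦not⟧*+⟦⟧* false m = sym (trans (+-identityʳ (m + 0)) (+-identityʳ m))

private variable
  a : Level
  A B : Set a

module _ {P : Pred A a} (P? : Decidable P) where

  length-filter-∷ : ∀ x xs → length (filter P? (x ∷ xs)) ≡ ⟦ does (P? x) ⟧ + length (filter P? xs)
  length-filter-∷ x xs with does (P? x)
  ... | true  = refl
  ... | false = refl

  length-filter-concatMap : (g : B → List A) (xs : List B) →
                            length (filter P? (concatMap g xs)) ≡ sum (map (length ∘ filter P? ∘ g) xs)
  length-filter-concatMap g []       = refl
  length-filter-concatMap g (x ∷ xs) = begin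
    length (filter P? (g x ++ concatMap g xs))
      ≡⟨ cong length (filter-++ P? (g x) _) ⟩
    length (filter P? (g x) ++ filter P? (concatMap g xs))
      ≡⟨ length-++ (filter P? (g x)) ⟩
    length (filter P? (g x)) + length (filter P? (concatMap g xs))
      ≡⟨ cong (length (filter P? (g x)) +_) (length-filter-concatMap g xs) ⟩
    length (filter P? (g x)) + sum (map (length ∘ filter P? ∘ g) xs) ∎

length-filter-map : {P : Pred A a} (P? : Decidable P) (h : B → A) (ys : List B) →
                    length (filter P? (map h ys)) ≡ length (filter (P? ∘ h) ys)
length-filter-map P? h []       = refl
length-filter-map P? h (y ∷ ys) = begin
  length (filter P? (h y ∷ map h ys))               ≡⟨ length-filter-∷ P? (h y) (map h ys) ⟩
  ⟦ does (P? (h y)) ⟧ + length (filter P? (map h ys)) ≡⟨ cong (⟦ does (P? (h y)) ⟧ +_) (length-filter-map P? h ys) ⟩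
  ⟦ does (P? (h y)) ⟧ + length (filter (P? ∘ h) ys)   ≡⟨ sym (length-filter-∷ (P? ∘ h) y ys) ⟩
  length (filter (P? ∘ h) (y ∷ ys))                 ∎

sum-allFin : ∀ n (g : ℕ → ℕ) → sum (map (g ∘ toℕ) (allFin n)) ≡ ∑< n g
sum-allFin n g = trans (cong sum (map-tabulate {n = n} id (g ∘ toℕ))) (sum-tabulate n g)
  where
  sum-tabulate : ∀ n (g : ℕ → ℕ) → sum (tabulate {n = n} (g ∘ toℕ)) ≡ ∑< n g
  sum-tabulate zero    g = refl
  sum-tabulate (suc n) g = cong (g 0 +_) (sum-tabulate n (g ∘ suc))

length-filter-allVecs : ∀ n k {P : Pred (Vec (Fin n) k) a} (P? : Decidable P) (f : Vec ℕ k → ℕ) →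
                        (∀ v → ⟦ does (P? v) ⟧ ≡ f (vmap toℕ v)) → length (filter P? (allVecs n k)) ≡ ∑ᵛ n k f
length-filter-allVecs n zero    P? f P?≡f = trans (length-filter-∷ P? [] []) (trans (+-identityʳ _) (P?≡f []))
length-filter-allVecs n (suc k) P? f P?≡f = begin
  length (filter P? (concatMap (λ x → map (x ∷_) (allVecs n k)) (allFin n)))
    ≡⟨ length-filter-concatMap P? _ (allFin n) ⟩
  sum (map (λ x → length (filter P? (map (x ∷_) (allVecs n k)))) (allFin n))
    ≡⟨ cong sum (map-cong count-row (allFin n)) ⟩
  sum (map (λ x → ∑ᵛ n k (f ∘ (toℕ x ∷_))) (allFin n))
    ≡⟨ sum-allFin n (λ x → ∑ᵛ n k (f ∘ (x ∷_))) ⟩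
  ∑ᵛ n (suc k) f ∎
  where
  count-row : ∀ x → length (filter P? (map (x ∷_) (allVecs n k))) ≡ ∑ᵛ n k (f ∘ (toℕ x ∷_))
  count-row x = trans (length-filter-map P? (x ∷_) (allVecs n k))
                      (length-filter-allVecs n k (P? ∘ (x ∷_)) (f ∘ (toℕ x ∷_)) (P?≡f ∘ (x ∷_)))

[_∣_] : ℕ → ℕ → ℕ
[ d ∣ m ] = ⟦ does (d ∣? m) ⟧

‖_‖² : ∀ {k} → Vec ℕ k → ℕ
‖ []     ‖² = 0
‖ x ∷ xs ‖² = x * x + ‖ xs ‖²

ρ : ℕ → ℕ → ℕ
ρ k n = ∑ᵛ n k (λ x → [ n ∣ ‖ x ‖² ])

ρ₀≡ρ : ∀ k n → ρ₀ k n ≡ ρ k n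
ρ₀≡ρ k n = length-filter-allVecs n k (λ v → n ∣? sumSq v) (λ x → [ n ∣ ‖ x ‖² ]) (cong [ n ∣_] ∘ sumSq≡‖toℕ‖²)
  where
  sumSq≡‖toℕ‖² : ∀ {k} (v : Vec (Fin n) k) → sumSq v ≡ ‖ vmap toℕ v ‖²
  sumSq≡‖toℕ‖² []       = refl
  sumSq≡‖toℕ‖² (x ∷ xs) = cong (toℕ x * toℕ x +_) (sumSq≡‖toℕ‖² xs)

[∣]≡1 : ∀ {d m} → d ∣ m → [ d ∣ m ] ≡ 1
[∣]≡1 {d} {m} d∣m with d ∣? m
... | yes _   = refl
... | no d∤m = contradiction d∣m d∤m

[∣]≡0 : ∀ {d m} → ¬ d ∣ m → [ d ∣ m ] ≡ 0
[∣]≡0 {d} {m} d∤m with d ∣? m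
... | yes d∣m = contradiction d∣m d∤m
... | no _    = refl

[∣]-elim : ∀ {d m} (P : ℕ → Set) → (d ∣ m → P 1) → (¬ d ∣ m → P 0) → P [ d ∣ m ]
[∣]-elim {d} {m} P yes-case no-case with d ∣? m
... | yes d∣m = yes-case d∣m
... | no d∤m  = no-case d∤m

does-∣?-cong : ∀ {d m d′ m′} → (d ∣ m → d′ ∣ m′) → (d′ ∣ m′ → d ∣ m) → does (d ∣? m) ≡ does (d′ ∣? m′)
does-∣?-cong {d} {m} {d′} {m′} to from with d ∣? m | d′ ∣? m′
... | yes _   | yes _    = refl
... | no _    | no _     = refl
... | yes d∣m | no d′∤m′ = contradiction (to d∣m) d′∤m′
... | no d∤m  | yes d′∣m′ = contradiction (from d′∣m′) d∤m

[∣]-cong : ∀ {d m d′ m′} → (d ∣ m → d′ ∣ m′) → (d′ ∣ m′ → d ∣ m) → [ d ∣ m ] ≡ [ d′ ∣ m′ ]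
[∣]-cong {d} {m} {d′} {m′} to from = cong ⟦_⟧ (does-∣?-cong {d} {m} {d′} {m′} to from)

[∣]-*-cancel : ∀ c .{{_ : NonZero c}} m n → [ c * m ∣ c * n ] ≡ [ m ∣ n ]
[∣]-*-cancel c m n = [∣]-cong {c * m} {c * n} {m} {n} (*-cancelˡ-∣ c) (*-monoʳ-∣ c)

-- Linear congruences modulo a prime

∑-indicator : ∀ n z₀ (g : ℕ → ℕ) → z₀ < n → g z₀ ≡ 1 → (∀ x → x < n → x ≢ z₀ → g x ≡ 0) → ∑< n g ≡ 1
∑-indicator (suc n) zero     g _          g0≡1  g≡0 = cong₂ _+_ g0≡1 (begin
  ∑< n (g ∘ suc)   ≡⟨ ∑-cong-< n (λ x x<n → g≡0 (suc x) (s≤s x<n) (λ ())) ⟩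
  ∑[ _ < n ] 0     ≡⟨ ∑-const n 0 ⟩
  n * 0            ≡⟨ *-zeroʳ n ⟩
  0                ∎)
∑-indicator (suc n) (suc z₀) g (s≤s z₀<n) gz₀≡1 g≡0 = cong₂ _+_ (g≡0 0 (s≤s z≤n) (λ ()))
  (∑-indicator n z₀ (g ∘ suc) z₀<n gz₀≡1 (λ x x<n x≢z₀ → g≡0 (suc x) (s≤s x<n) (x≢z₀ ∘ suc-injective)))

∣∧<⇒≡0 : ∀ {d n} → d ∣ n → n < d → n ≡ 0
∣∧<⇒≡0 {n = zero}  _   _   = refl
∣∧<⇒≡0 {n = suc n} d∣n n<d = contradiction (∣⇒≤ d∣n) (<⇒≱ n<d)

module _ {p : ℕ} (p-prime : Prime p) where

  private instance
    p≢0 : NonZero p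
    p≢0 = prime⇒nonZero p-prime

  prime∤⇒coprime : ∀ {u} → ¬ p ∣ u → Coprime p u
  prime∤⇒coprime p∤u (d∣p , d∣u) with prime⇒irreducible p-prime d∣p
  ... | inj₁ d≡1  = d≡1
  ... | inj₂ refl = contradiction d∣u p∤u

  prime∤* : ∀ {m n} → ¬ p ∣ m → ¬ p ∣ n → ¬ p ∣ m * n
  prime∤* {m} {n} p∤m p∤n = [ p∤m , p∤n ] ∘ euclidsLemma m n p-prime

  module _ {u : ℕ} (p∤u : ¬ p ∣ u) where

    linear-congruence-solvable : ∀ d → ∃[ z ] p ∣ d + u * z
    linear-congruence-solvable d with coprime-Bézout (prime∤⇒coprime p∤u)
    ... | Bézout.+- x y 1+yu≡xp = y * d , divides (x * d) (begin
      d + u * (y * d)   ≡⟨ solve 3 (λ d u y → d :+ u :* (y :* d) := (con 1 :+ y :* u) :* d) refl d u y ⟩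
      (1 + y * u) * d   ≡⟨ cong (_* d) 1+yu≡xp ⟩
      x * p * d         ≡⟨ solve 3 (λ x p d → x :* p :* d := x :* d :* p) refl x p d ⟩
      x * d * p         ∎)
    -- Here y inverts u modulo p, and q = p - 1 plays the role of -1.
    ... | Bézout.-+ x y 1+xp≡yu = y * (q * d) , divides (d + x * (q * d)) (begin
      d + u * (y * (q * d))           ≡⟨ solve 4 (λ d u y q → d :+ u :* (y :* (q :* d)) := d :+ y :* u :* (q :* d)) refl d u y q ⟩
      d + y * u * (q * d)             ≡⟨ cong (λ t → d + t * (q * d)) (sym 1+xp≡yu) ⟩
      d + (1 + x * p) * (q * d)       ≡⟨ solve 4 (λ d x p q → d :+ (con 1 :+ x :* p) :* (q :* d)
                                                            := (con 1 :+ q) :* d :+ x :* p :* (q :* d)) refl d x p q ⟩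
      suc q * d + x * p * (q * d)     ≡⟨ cong (λ t → t * d + x * p * (q * d)) (suc-pred p) ⟩
      p * d + x * p * (q * d)         ≡⟨ solve 4 (λ d x p q → p :* d :+ x :* p :* (q :* d) := (d :+ x :* (q :* d)) :* p) refl d x p q ⟩
      (d + x * (q * d)) * p           ∎)
      where q = pred p

    linear-congruence-solvable< : ∀ d → ∃[ z ] z < p × p ∣ d + u * z
    linear-congruence-solvable< d with linear-congruence-solvable d
    ... | z , p∣d+uz = z % p , m%n<n z p , ∣m+n∣m⇒∣n (subst (p ∣_) split p∣d+uz) (n∣m*n (u * (z / p)))
      where
      split : d + u * z ≡ u * (z / p) * p + (d + u * (z % p))
      split = begin
        d + u * z                          ≡⟨ cong (λ t → d + u * t) (m≡m%n+[m/n]*n z p) ⟩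
        d + u * (z % p + z / p * p)        ≡⟨ solve 5 (λ d u r s p → d :+ u :* (r :+ s :* p) := u :* s :* p :+ (d :+ u :* r))
                                                refl d u (z % p) (z / p) p ⟩
        u * (z / p) * p + (d + u * (z % p)) ∎

    linear-congruence-unique≤ : ∀ {d z₁ z₂} → z₁ ≤ z₂ → z₂ < p → p ∣ d + u * z₁ → p ∣ d + u * z₂ → z₁ ≡ z₂
    linear-congruence-unique≤ {d} {z₁} {z₂} z₁≤z₂ z₂<p p∣d+uz₁ p∣d+uz₂ = begin
      z₁           ≡⟨ sym (+-identityʳ z₁) ⟩
      z₁ + 0       ≡⟨ cong (z₁ +_) (sym e≡0) ⟩
      z₁ + e       ≡⟨ m+[n∸m]≡n z₁≤z₂ ⟩
      z₂           ∎
      where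
      e = z₂ ∸ z₁
      split : d + u * z₂ ≡ d + u * z₁ + u * e
      split = begin
        d + u * z₂           ≡⟨ cong (λ t → d + u * t) (sym (m+[n∸m]≡n z₁≤z₂)) ⟩
        d + u * (z₁ + e)     ≡⟨ solve 4 (λ d u a b → d :+ u :* (a :+ b) := d :+ u :* a :+ u :* b) refl d u z₁ e ⟩
        d + u * z₁ + u * e   ∎
      p∣e : p ∣ e
      p∣e = [ ⊥-elim ∘ p∤u , id ]′ (euclidsLemma u e p-prime (∣m+n∣m⇒∣n (subst (p ∣_) split p∣d+uz₂) p∣d+uz₁))
      e≡0 : e ≡ 0
      e≡0 = ∣∧<⇒≡0 p∣e (≤-<-trans (m∸n≤m z₂ z₁) z₂<p)

    linear-congruence-unique : ∀ {d z₁ z₂} → z₁ < p → z₂ < p → p ∣ d + u * z₁ → p ∣ d + u * z₂ → z₁ ≡ z₂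
    linear-congruence-unique {z₁ = z₁} {z₂} z₁<p z₂<p h₁ h₂ with ≤-total z₁ z₂
    ... | inj₁ z₁≤z₂ = linear-congruence-unique≤ z₁≤z₂ z₂<p h₁ h₂
    ... | inj₂ z₂≤z₁ = sym (linear-congruence-unique≤ z₂≤z₁ z₁<p h₂ h₁)

    linear-congruence-count : ∀ d → ∑[ z < p ] [ p ∣ d + u * z ] ≡ 1
    linear-congruence-count d = count (linear-congruence-solvable< d)
      where
      count : ∃[ z₀ ] z₀ < p × p ∣ d + u * z₀ → ∑[ z < p ] [ p ∣ d + u * z ] ≡ 1
      count (z₀ , z₀<p , p∣d+uz₀) = ∑-indicator p z₀ (λ z → [ p ∣ d + u * z ]) z₀<p ([∣]≡1 p∣d+uz₀)
        (λ z z<p z≢z₀ → [∣]≡0 (z≢z₀ ∘ λ p∣d+uz → linear-congruence-unique z<p z₀<p p∣d+uz p∣d+uz₀))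

-- Lifting nonsingular solutions

_·_ : ∀ {k} → Vec ℕ k → Vec ℕ k → ℕ
[]       · []       = 0
(z ∷ zs) · (y ∷ ys) = z * y + zs · ys

allDivisible : ∀ {k} → ℕ → Vec ℕ k → Bool
allDivisible p []       = true
allDivisible p (x ∷ xs) = does (p ∣? x) ∧ allDivisible p xs

module _ {p : ℕ} (p-prime : Prime p) {u : ℕ} (p∤u : ¬ p ∣ u) where

  hyperplane-count : ∀ {k} (y : Vec ℕ k) → allDivisible p y ≡ false →
                     ∀ c → ∑ᵛ p k (λ z → [ p ∣ c + u * (z · y) ]) ≡ p ^ (k ∸ 1)
  hyperplane-count-∷ : ∀ {k} y₀ (ys : Vec ℕ k) (p∣?y₀ : Dec (p ∣ y₀)) → does p∣?y₀ ∧ allDivisible p ys ≡ false →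
                       ∀ c → ∑ᵛ p (suc k) (λ z → [ p ∣ c + u * (z · (y₀ ∷ ys)) ]) ≡ p ^ k

  hyperplane-count []        ()
  hyperplane-count (y₀ ∷ ys) y≢0 = hyperplane-count-∷ y₀ ys (p ∣? y₀) y≢0

  hyperplane-count-∷ y₀ [] (yes _) ()
  hyperplane-count-∷ {suc k} y₀ ys (yes p∣y₀) ys≢0 c = begin
    ∑[ z₀ < p ] ∑ᵛ p (suc k) (λ z → [ p ∣ c + u * (z₀ * y₀ + z · ys) ])
      ≡⟨ ∑-cong p (λ z₀ → trans (∑ᵛ-cong p (suc k) (λ z → cong [ p ∣_] (regroup z₀ (z · ys))))
                                (hyperplane-count ys ys≢0 (c + u * (z₀ * y₀)))) ⟩
    ∑[ _ < p ] p ^ k   ≡⟨ ∑-const p _ ⟩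
    p ^ suc k          ∎
    where
    regroup : ∀ z₀ s → c + u * (z₀ * y₀ + s) ≡ c + u * (z₀ * y₀) + u * s
    regroup z₀ s = solve 5 (λ c u z₀ y₀ s → c :+ u :* (z₀ :* y₀ :+ s) := c :+ u :* (z₀ :* y₀) :+ u :* s) refl c u z₀ y₀ s
  hyperplane-count-∷ {k} y₀ ys (no p∤y₀) _ c = begin
    ∑[ z₀ < p ] ∑ᵛ p k (λ z → [ p ∣ c + u * (z₀ * y₀ + z · ys) ])
      ≡⟨ ∑-∑ᵛ-comm p p k _ ⟩
    ∑ᵛ p k (λ z → ∑[ z₀ < p ] [ p ∣ c + u * (z₀ * y₀ + z · ys) ])
      ≡⟨ ∑ᵛ-cong p k (λ z → trans (∑-cong p (λ z₀ → cong [ p ∣_] (regroup z₀ (z · ys))))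
                                  (linear-congruence-count p-prime (prime∤* p-prime p∤u p∤y₀) (c + u * (z · ys)))) ⟩
    ∑ᵛ p k (λ _ → 1)   ≡⟨ ∑ᵛ-const p k 1 ⟩
    p ^ k * 1          ≡⟨ *-identityʳ _ ⟩
    p ^ k              ∎
    where
    regroup : ∀ z₀ s → c + u * (z₀ * y₀ + s) ≡ c + u * s + u * y₀ * z₀
    regroup z₀ s = solve 5 (λ c u z₀ y₀ s → c :+ u :* (z₀ :* y₀ :+ s) := c :+ u :* s :+ u :* y₀ :* z₀) refl c u z₀ y₀ s

‖combine‖² : ∀ {k} b (zs ys : Vec ℕ k) → ‖ combine b zs ys ‖² ≡ b * b * ‖ zs ‖² + 2 * b * (zs · ys) + ‖ ys ‖²
‖combine‖² b []       []       = solve 1 (λ b → con 0 := b :* b :* con 0 :+ con 2 :* b :* con 0 :+ con 0) refl b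
‖combine‖² b (z ∷ zs) (y ∷ ys) = begin
  (z * b + y) * (z * b + y) + ‖ combine b zs ys ‖²
    ≡⟨ cong ((z * b + y) * (z * b + y) +_) (‖combine‖² b zs ys) ⟩
  (z * b + y) * (z * b + y) + (b * b * ‖ zs ‖² + 2 * b * (zs · ys) + ‖ ys ‖²)
    ≡⟨ solve 6 (λ b z y A B C → (z :* b :+ y) :* (z :* b :+ y) :+ (b :* b :* A :+ con 2 :* b :* B :+ C)
                             := b :* b :* (z :* z :+ A) :+ con 2 :* b :* (z :* y :+ B) :+ (y :* y :+ C))
             refl b z y ‖ zs ‖² (zs · ys) ‖ ys ‖² ⟩
  b * b * ‖ z ∷ zs ‖² + 2 * b * ((z ∷ zs) · (y ∷ ys)) + ‖ y ∷ ys ‖² ∎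

allDivisible-combine : ∀ {p b k} → p ∣ b → (zs ys : Vec ℕ k) → allDivisible p (combine b zs ys) ≡ allDivisible p ys
allDivisible-combine             p∣b []       []       = refl
allDivisible-combine {p} {b} p∣b (z ∷ zs) (y ∷ ys) = cong₂ _∧_
  (does-∣?-cong (λ p∣zb+y → ∣m+n∣m⇒∣n p∣zb+y p∣zb) (∣m∣n⇒∣m+n p∣zb))
  (allDivisible-combine p∣b zs ys)
  where
  p∣zb : p ∣ z * b
  p∣zb = ∣-trans p∣b (n∣m*n z)

odd-prime∤2 : ∀ {p} → Prime p → p ≢ 2 → ¬ p ∣ 2
odd-prime∤2 {p} p-prime p≢2 p∣2 = p≢2 (≤-antisym (∣⇒≤ p∣2) (nonTrivial⇒n>1 p {{prime⇒nonTrivial p-prime}}))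

q∣q*q*a+2*q*b : ∀ q a b → q ∣ q * q * a + 2 * q * b
q∣q*q*a+2*q*b q a b = divides (q * a + 2 * b)
  (solve 3 (λ q a b → q :* q :* a :+ con 2 :* q :* b := (q :* a :+ con 2 :* b) :* q) refl q a b)

[∣]-lift : ∀ {p q} .{{_ : NonZero q}} → p ∣ q → ∀ a b c →
           [ p * q ∣ q * q * a + 2 * q * b + c * q ] ≡ [ p ∣ c + 2 * b ]
[∣]-lift {p} {q} p∣q a b c = [∣]-cong {p * q} {q * q * a + 2 * q * b + c * q} {p} {c + 2 * b} to from
  where
  factor : q * q * a + 2 * q * b + c * q ≡ q * (q * a + (c + 2 * b))
  factor = solve 4 (λ q a b c → q :* q :* a :+ con 2 :* q :* b :+ c :* q := q :* (q :* a :+ (c :+ con 2 :* b))) refl q a b c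
  p∣qa : p ∣ q * a
  p∣qa = ∣-trans p∣q (m∣m*n a)
  to : p * q ∣ q * q * a + 2 * q * b + c * q → p ∣ c + 2 * b
  to pq∣ = ∣m+n∣m⇒∣n (*-cancelˡ-∣ q (subst₂ _∣_ (*-comm p q) factor pq∣)) p∣qa
  from : p ∣ c + 2 * b → p * q ∣ q * q * a + 2 * q * b + c * q
  from p∣ = subst₂ _∣_ (*-comm q p) (sym factor) (*-monoʳ-∣ q (∣m∣n⇒∣m+n p∣qa p∣))

module _ {p : ℕ} (p-prime : Prime p) (p≢2 : p ≢ 2) where

  hensel-count : ∀ {q} .{{_ : NonZero q}} → p ∣ q → ∀ {k} (y : Vec ℕ k) → allDivisible p y ≡ false →
                 ∑ᵛ p k (λ z → [ p * q ∣ ‖ combine q z y ‖² ]) ≡ [ q ∣ ‖ y ‖² ] * p ^ (k ∸ 1)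
  hensel-count {q} p∣q {k} y y≢0 =
    [∣]-elim (λ b → ∑ᵛ p k (λ z → [ p * q ∣ ‖ combine q z y ‖² ]) ≡ b * p ^ (k ∸ 1)) lifts no-lift
    where
    expand : ∀ z → [ p * q ∣ ‖ combine q z y ‖² ] ≡ [ p * q ∣ q * q * ‖ z ‖² + 2 * q * (z · y) + ‖ y ‖² ]
    expand z = cong [ p * q ∣_] (‖combine‖² q z y)
    lifts : q ∣ ‖ y ‖² → ∑ᵛ p k (λ z → [ p * q ∣ ‖ combine q z y ‖² ]) ≡ 1 * p ^ (k ∸ 1)
    lifts (divides c ‖y‖²≡cq) = begin
      ∑ᵛ p k (λ z → [ p * q ∣ ‖ combine q z y ‖² ])
        ≡⟨ ∑ᵛ-cong p k (λ z → trans (expand z) (trans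
             (cong (λ t → [ p * q ∣ q * q * ‖ z ‖² + 2 * q * (z · y) + t ]) ‖y‖²≡cq)
             ([∣]-lift p∣q ‖ z ‖² (z · y) c))) ⟩
      ∑ᵛ p k (λ z → [ p ∣ c + 2 * (z · y) ])
        ≡⟨ hyperplane-count p-prime (odd-prime∤2 p-prime p≢2) y y≢0 c ⟩
      p ^ (k ∸ 1)
        ≡⟨ sym (*-identityˡ _) ⟩
      1 * p ^ (k ∸ 1) ∎
    no-lift : ¬ q ∣ ‖ y ‖² → ∑ᵛ p k (λ z → [ p * q ∣ ‖ combine q z y ‖² ]) ≡ 0 * p ^ (k ∸ 1)
    no-lift q∤‖y‖² = begin
      ∑ᵛ p k (λ z → [ p * q ∣ ‖ combine q z y ‖² ])
        ≡⟨ ∑ᵛ-cong p k (λ z → trans (expand z) ([∣]≡0 (λ pq∣ →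
             q∤‖y‖² (∣m+n∣m⇒∣n (m*n∣⇒n∣ p q pq∣) (q∣q*q*a+2*q*b q ‖ z ‖² (z · y)))))) ⟩
      ∑ᵛ p k (λ _ → 0)   ≡⟨ ∑ᵛ-const p k 0 ⟩
      p ^ k * 0          ≡⟨ *-zeroʳ (p ^ k) ⟩
      0                  ∎

-- Singular and nonsingular solutions

ρ-nonsingular : ℕ → ℕ → ℕ → ℕ
ρ-nonsingular p k n = ∑ᵛ n k (λ x → ⟦ not (allDivisible p x) ⟧ * [ n ∣ ‖ x ‖² ])

ρ-singular : ℕ → ℕ → ℕ → ℕ
ρ-singular p k n = ∑ᵛ n k (λ x → ⟦ allDivisible p x ⟧ * [ n ∣ ‖ x ‖² ])

ρ-split : ∀ p k n → ρ k n ≡ ρ-nonsingular p k n + ρ-singular p k n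
ρ-split p k n = trans (∑ᵛ-cong n k (λ x → ⟦not⟧*+⟦⟧* (allDivisible p x) [ n ∣ ‖ x ‖² ]))
  (∑ᵛ-distrib-+ n k (λ x → ⟦ not (allDivisible p x) ⟧ * [ n ∣ ‖ x ‖² ]) (λ x → ⟦ allDivisible p x ⟧ * [ n ∣ ‖ x ‖² ]))

module _ {p : ℕ} (p-prime : Prime p) (p≢2 : p ≢ 2) (k : ℕ) where

  ρ-nonsingular-* : ∀ {q} .{{_ : NonZero q}} → p ∣ q → ρ-nonsingular p k (p * q) ≡ ρ-nonsingular p k q * p ^ (k ∸ 1)
  ρ-nonsingular-* {q} p∣q = begin
    ∑ᵛ (p * q) k F
      ≡⟨ ∑ᵛ-* p q k F ⟩
    ∑ᵛ p k (λ z → ∑ᵛ q k (F ∘ combine q z))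
      ≡⟨ ∑ᵛ-comm p q k k (λ z → F ∘ combine q z) ⟩
    ∑ᵛ q k (λ y → ∑ᵛ p k (λ z → F (combine q z y)))
      ≡⟨ ∑ᵛ-cong q k fibre ⟩
    ∑ᵛ q k (λ y → ⟦ not (allDivisible p y) ⟧ * [ q ∣ ‖ y ‖² ] * p ^ (k ∸ 1))
      ≡⟨ sym (*-distribʳ-∑ᵛ q k (p ^ (k ∸ 1)) (λ y → ⟦ not (allDivisible p y) ⟧ * [ q ∣ ‖ y ‖² ])) ⟩
    ρ-nonsingular p k q * p ^ (k ∸ 1) ∎
    where
    F : Vec ℕ k → ℕ
    F x = ⟦ not (allDivisible p x) ⟧ * [ p * q ∣ ‖ x ‖² ]
    fibre-from : ∀ y b → allDivisible p y ≡ b →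
                 ⟦ not b ⟧ * ∑ᵛ p k (λ z → [ p * q ∣ ‖ combine q z y ‖² ]) ≡ ⟦ not b ⟧ * [ q ∣ ‖ y ‖² ] * p ^ (k ∸ 1)
    fibre-from y true  _   = refl
    fibre-from y false y≢0 = begin
      1 * ∑ᵛ p k (λ z → [ p * q ∣ ‖ combine q z y ‖² ]) ≡⟨ *-identityˡ _ ⟩
      ∑ᵛ p k (λ z → [ p * q ∣ ‖ combine q z y ‖² ])     ≡⟨ hensel-count p-prime p≢2 p∣q y y≢0 ⟩
      [ q ∣ ‖ y ‖² ] * p ^ (k ∸ 1)                      ≡⟨ cong (_* p ^ (k ∸ 1)) (sym (*-identityˡ [ q ∣ ‖ y ‖² ])) ⟩
      1 * [ q ∣ ‖ y ‖² ] * p ^ (k ∸ 1)                  ∎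
    fibre : ∀ y → ∑ᵛ p k (λ z → F (combine q z y)) ≡ ⟦ not (allDivisible p y) ⟧ * [ q ∣ ‖ y ‖² ] * p ^ (k ∸ 1)
    fibre y = begin
      ∑ᵛ p k (λ z → F (combine q z y))
        ≡⟨ ∑ᵛ-cong p k (λ z → cong (λ b → ⟦ not b ⟧ * [ p * q ∣ ‖ combine q z y ‖² ]) (allDivisible-combine p∣q z y)) ⟩
      ∑ᵛ p k (λ z → ⟦ not (allDivisible p y) ⟧ * [ p * q ∣ ‖ combine q z y ‖² ])
        ≡⟨ sym (*-distribˡ-∑ᵛ p k ⟦ not (allDivisible p y) ⟧ (λ z → [ p * q ∣ ‖ combine q z y ‖² ])) ⟩
      ⟦ not (allDivisible p y) ⟧ * ∑ᵛ p k (λ z → [ p * q ∣ ‖ combine q z y ‖² ])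
        ≡⟨ fibre-from y (allDivisible p y) refl ⟩
      ⟦ not (allDivisible p y) ⟧ * [ q ∣ ‖ y ‖² ] * p ^ (k ∸ 1) ∎

ρ-1 : ∀ k → ρ k 1 ≡ 1
ρ-1 k = ∑ᵛ-1 k (λ x → [ 1 ∣ ‖ x ‖² ]) (λ x → [∣]≡1 (1∣ ‖ x ‖²))

‖map-*‖² : ∀ {k} d (w : Vec ℕ k) → ‖ vmap (_* d) w ‖² ≡ d * d * ‖ w ‖²
‖map-*‖² d []       = sym (*-zeroʳ (d * d))
‖map-*‖² d (w ∷ ws) = begin
  w * d * (w * d) + ‖ vmap (_* d) ws ‖²  ≡⟨ cong (w * d * (w * d) +_) (‖map-*‖² d ws) ⟩
  w * d * (w * d) + d * d * ‖ ws ‖²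
    ≡⟨ solve 3 (λ d w A → w :* d :* (w :* d) :+ d :* d :* A := d :* d :* (w :* w :+ A)) refl d w ‖ ws ‖² ⟩
  d * d * ‖ w ∷ ws ‖²                    ∎

∑-multiples : ∀ d m .{{_ : NonZero d}} (h : ℕ → ℕ) → ∑[ x < m * d ] [ d ∣ x ] * h x ≡ ∑[ w < m ] h (w * d)
∑-multiples (suc d) m h = trans (∑-* m (suc d) (λ x → [ suc d ∣ x ] * h x)) (∑-cong m fibre)
  where
  D = suc d
  fibre : ∀ w → (∑[ y < D ] [ D ∣ w * D + y ] * h (w * D + y)) ≡ h (w * D)
  fibre w = begin
    [ D ∣ w * D + 0 ] * h (w * D + 0) + (∑[ y < d ] [ D ∣ w * D + suc y ] * h (w * D + suc y))
      ≡⟨ cong₂ _+_ (cong (λ x → [ D ∣ x ] * h x) (+-identityʳ (w * D)))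
                   (∑-cong-< d (λ y y<d → cong (_* h (w * D + suc y)) ([∣]≡0 {D} {w * D + suc y}
                      (λ D∣ → <⇒≱ (s≤s y<d) (∣⇒≤ (∣m+n∣m⇒∣n D∣ (n∣m*n w))))))) ⟩
    [ D ∣ w * D ] * h (w * D) + (∑[ _ < d ] 0)
      ≡⟨ cong₂ _+_ (cong (_* h (w * D)) ([∣]≡1 {D} {w * D} (n∣m*n w))) (trans (∑-const d 0) (*-zeroʳ d)) ⟩
    1 * h (w * D) + 0
      ≡⟨ trans (+-identityʳ _) (*-identityˡ _) ⟩
    h (w * D) ∎

∑ᵛ-allDivisible : ∀ d m k .{{_ : NonZero d}} (g : Vec ℕ k → ℕ) →
                  ∑ᵛ (m * d) k (λ x → ⟦ allDivisible d x ⟧ * g x) ≡ ∑ᵛ m k (g ∘ vmap (_* d))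
∑ᵛ-allDivisible d m zero    g = +-identityʳ (g [])
∑ᵛ-allDivisible d m (suc k) g = begin
  ∑[ x < m * d ] ∑ᵛ (m * d) k (λ xs → ⟦ does (d ∣? x) ∧ allDivisible d xs ⟧ * g (x ∷ xs))
    ≡⟨ ∑-cong (m * d) (λ x → trans (∑ᵛ-cong (m * d) k (factor x))
                                    (sym (*-distribˡ-∑ᵛ (m * d) k [ d ∣ x ] (λ xs → ⟦ allDivisible d xs ⟧ * g (x ∷ xs))))) ⟩
  ∑[ x < m * d ] [ d ∣ x ] * ∑ᵛ (m * d) k (λ xs → ⟦ allDivisible d xs ⟧ * g (x ∷ xs))
    ≡⟨ ∑-multiples d m (λ x → ∑ᵛ (m * d) k (λ xs → ⟦ allDivisible d xs ⟧ * g (x ∷ xs))) ⟩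
  ∑[ w < m ] ∑ᵛ (m * d) k (λ xs → ⟦ allDivisible d xs ⟧ * g (w * d ∷ xs))
    ≡⟨ ∑-cong m (λ w → ∑ᵛ-allDivisible d m k (g ∘ (w * d ∷_))) ⟩
  ∑[ w < m ] ∑ᵛ m k (λ ws → g (w * d ∷ vmap (_* d) ws)) ∎
  where
  factor : ∀ x xs → ⟦ does (d ∣? x) ∧ allDivisible d xs ⟧ * g (x ∷ xs) ≡ [ d ∣ x ] * (⟦ allDivisible d xs ⟧ * g (x ∷ xs))
  factor x xs = trans (cong (_* g (x ∷ xs)) (⟦∧⟧ (does (d ∣? x)) (allDivisible d xs)))
                      (*-assoc [ d ∣ x ] ⟦ allDivisible d xs ⟧ (g (x ∷ xs)))

[∣‖combine‖²] : ∀ {k} m (z y : Vec ℕ k) → [ m ∣ ‖ combine m z y ‖² ] ≡ [ m ∣ ‖ y ‖² ]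
[∣‖combine‖²] m z y = trans (cong [ m ∣_] (‖combine‖² m z y))
  ([∣]-cong {m} {m * m * ‖ z ‖² + 2 * m * (z · y) + ‖ y ‖²} {m} {‖ y ‖²}
            (λ m∣ → ∣m+n∣m⇒∣n m∣ (q∣q*q*a+2*q*b m ‖ z ‖² (z · y))) (∣m∣n⇒∣m+n (q∣q*q*a+2*q*b m ‖ z ‖² (z · y))))

module _ (p k : ℕ) .{{_ : NonZero p}} where

  ρ-singular-prime : ρ-singular p k p ≡ 1
  ρ-singular-prime = begin
    ∑ᵛ p k F              ≡⟨ cong (λ n → ∑ᵛ n k F) (sym (*-identityˡ p)) ⟩
    ∑ᵛ (1 * p) k F        ≡⟨ ∑ᵛ-allDivisible p 1 k (λ x → [ p ∣ ‖ x ‖² ]) ⟩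
    ∑ᵛ 1 k (λ w → [ p ∣ ‖ vmap (_* p) w ‖² ])
      ≡⟨ ∑ᵛ-1 k (λ w → [ p ∣ ‖ vmap (_* p) w ‖² ]) (λ w → [∣]≡1 (p∣‖pw‖² w)) ⟩
    1                     ∎
    where
    F : Vec ℕ k → ℕ
    F x = ⟦ allDivisible p x ⟧ * [ p ∣ ‖ x ‖² ]
    p∣‖pw‖² : ∀ w → p ∣ ‖ vmap (_* p) w ‖²
    p∣‖pw‖² w = subst (p ∣_) (sym (‖map-*‖² p w)) (∣-trans (n∣m*n p) (m∣m*n ‖ w ‖²))

  ρ-singular-* : ∀ m → ρ-singular p k (p * (p * m)) ≡ p ^ k * ρ k m
  ρ-singular-* m = begin
    ∑ᵛ (p * (p * m)) k F
      ≡⟨ cong (λ n → ∑ᵛ n k F) (*-comm p (p * m)) ⟩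
    ∑ᵛ (p * m * p) k F
      ≡⟨ ∑ᵛ-allDivisible p (p * m) k (λ x → [ p * (p * m) ∣ ‖ x ‖² ]) ⟩
    ∑ᵛ (p * m) k (λ w → [ p * (p * m) ∣ ‖ vmap (_* p) w ‖² ])
      ≡⟨ ∑ᵛ-cong (p * m) k descale ⟩
    ∑ᵛ (p * m) k (λ w → [ m ∣ ‖ w ‖² ])
      ≡⟨ ∑ᵛ-periodic p m k (λ w → [ m ∣ ‖ w ‖² ]) ([∣‖combine‖²] m) ⟩
    p ^ k * ρ k m ∎
    where
    F : Vec ℕ k → ℕ
    F x = ⟦ allDivisible p x ⟧ * [ p * (p * m) ∣ ‖ x ‖² ]
    descale : ∀ w → [ p * (p * m) ∣ ‖ vmap (_* p) w ‖² ] ≡ [ m ∣ ‖ w ‖² ]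
    descale w = trans (cong₂ [_∣_] (sym (*-assoc p p m)) (‖map-*‖² p w)) ([∣]-*-cancel (p * p) {{m*n≢0 p p}} m ‖ w ‖²)

-- The recursion in the exponent

^-*-suc : ∀ p k m → p ^ (k * suc m) ≡ p ^ k * p ^ (k * m)
^-*-suc p k m = trans (cong (p ^_) (*-suc k m)) (^-distribˡ-+-* p k (k * m))

Ω-shift : ∀ k p s N → Ω k p (suc (suc s)) (suc N) ≡ p ^ (suc s * (k ∸ 1)) + p ^ k * Ω k p s N
Ω-shift k p s zero = cong (p ^ (suc s * (k ∸ 1)) +_)
  (trans (cong (λ t → p ^ (t + (s ∸ 1) * (k ∸ 1))) (*-identityʳ k)) (^-distribˡ-+-* p k ((s ∸ 1) * (k ∸ 1))))
Ω-shift k p s (suc N) = begin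
  Ω k p (suc (suc s)) (suc N) + p ^ (k * suc (suc N) + (suc (suc s) ∸ (2 * suc (suc N) + 1)) * (k ∸ 1))
    ≡⟨ cong (λ e → Ω k p (suc (suc s)) (suc N) + p ^ (k * suc (suc N) + (suc (suc s) ∸ e) * (k ∸ 1))) (2[2+N]+1≡2+[2[1+N]+1] N) ⟩
  Ω k p (suc (suc s)) (suc N) + p ^ (k * suc (suc N) + (s ∸ (2 * suc N + 1)) * (k ∸ 1))
    ≡⟨ cong₂ _+_ (Ω-shift k p s N) (^-distribˡ-+-* p (k * suc (suc N)) ((s ∸ (2 * suc N + 1)) * (k ∸ 1))) ⟩
  X + p ^ k * Ω k p s N + p ^ (k * suc (suc N)) * Y
    ≡⟨ cong (λ t → X + p ^ k * Ω k p s N + t * Y) (^-*-suc p k (suc N)) ⟩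
  X + p ^ k * Ω k p s N + p ^ k * p ^ (k * suc N) * Y
    ≡⟨ solve 5 (λ X K O Z Y → X :+ K :* O :+ K :* Z :* Y := X :+ K :* (O :+ Z :* Y)) refl X (p ^ k) (Ω k p s N) (p ^ (k * suc N)) Y ⟩
  X + p ^ k * (Ω k p s N + p ^ (k * suc N) * Y)
    ≡⟨ cong (λ t → X + p ^ k * (Ω k p s N + t)) (sym (^-distribˡ-+-* p (k * suc N) ((s ∸ (2 * suc N + 1)) * (k ∸ 1)))) ⟩
  X + p ^ k * Ω k p s (suc N) ∎
  where
  2[2+N]+1≡2+[2[1+N]+1] : ∀ N → 2 * suc (suc N) + 1 ≡ suc (suc (2 * suc N + 1))
  2[2+N]+1≡2+[2[1+N]+1] = solve 1 (λ N → con 2 :* (con 2 :+ N) :+ con 1 := con 2 :+ (con 2 :* (con 1 :+ N) :+ con 1)) refl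
  X = p ^ (suc s * (k ∸ 1))
  Y = p ^ ((s ∸ (2 * suc N + 1)) * (k ∸ 1))

module _ {p : ℕ} (p-prime : Prime p) (p≢2 : p ≢ 2) (k : ℕ) where

  private instance
    p≢0 : NonZero p
    p≢0 = prime⇒nonZero p-prime

  ρ-prime : ρ k p ≡ ρ-nonsingular p k p + 1
  ρ-prime = trans (ρ-split p k p) (cong (ρ-nonsingular p k p +_) (ρ-singular-prime p k))

  ρ-nonsingular-prime : ρ-nonsingular p k p ≡ ρ k p ∸ 1
  ρ-nonsingular-prime = trans (sym (m+n∸n≡m (ρ-nonsingular p k p) 1)) (cong (_∸ 1) (sym ρ-prime))

  ρ-nonsingular-prime-power : ∀ t → ρ-nonsingular p k (p ^ suc t) ≡ (ρ k p ∸ 1) * p ^ (t * (k ∸ 1))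
  ρ-nonsingular-prime-power zero = begin
    ρ-nonsingular p k (p * 1)   ≡⟨ cong (ρ-nonsingular p k) (*-identityʳ p) ⟩
    ρ-nonsingular p k p         ≡⟨ ρ-nonsingular-prime ⟩
    ρ k p ∸ 1                   ≡⟨ sym (*-identityʳ (ρ k p ∸ 1)) ⟩
    (ρ k p ∸ 1) * 1             ∎
  ρ-nonsingular-prime-power (suc t) = begin
    ρ-nonsingular p k (p * p ^ suc t)
      ≡⟨ ρ-nonsingular-* p-prime p≢2 k {{m^n≢0 p (suc t)}} (m∣m*n (p ^ t)) ⟩
    ρ-nonsingular p k (p ^ suc t) * p ^ (k ∸ 1)
      ≡⟨ cong (_* p ^ (k ∸ 1)) (ρ-nonsingular-prime-power t) ⟩
    (ρ k p ∸ 1) * p ^ (t * (k ∸ 1)) * p ^ (k ∸ 1)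
      ≡⟨ solve 3 (λ a x y → a :* x :* y := a :* (y :* x)) refl (ρ k p ∸ 1) (p ^ (t * (k ∸ 1))) (p ^ (k ∸ 1)) ⟩
    (ρ k p ∸ 1) * (p ^ (k ∸ 1) * p ^ (t * (k ∸ 1)))
      ≡⟨ cong ((ρ k p ∸ 1) *_) (sym (^-distribˡ-+-* p (k ∸ 1) (t * (k ∸ 1)))) ⟩
    (ρ k p ∸ 1) * p ^ (suc t * (k ∸ 1)) ∎

  ρ-prime-power-rec : ∀ t → ρ k (p ^ suc (suc t)) ≡ (ρ k p ∸ 1) * p ^ (suc t * (k ∸ 1)) + p ^ k * ρ k (p ^ t)
  ρ-prime-power-rec t = trans (ρ-split p k (p ^ suc (suc t))) (cong₂ _+_ (ρ-nonsingular-prime-power (suc t)) (ρ-singular-* p k (p ^ t)))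

  ρ-prime-power : ∀ s → ρ k (p ^ suc s) ≡ Ω k p (suc s) (s / 2) * (ρ k p ∸ 1) + p ^ (k * (suc s / 2))
  ρ-prime-power zero = begin
    ρ k (p * 1)                   ≡⟨ cong (ρ k) (*-identityʳ p) ⟩
    ρ k p                         ≡⟨ ρ-prime ⟩
    ρ-nonsingular p k p + 1
      ≡⟨ cong₂ _+_ (trans ρ-nonsingular-prime (sym (*-identityˡ (ρ k p ∸ 1)))) (cong (p ^_) (sym (*-zeroʳ k))) ⟩
    1 * (ρ k p ∸ 1) + p ^ (k * 0) ∎
  ρ-prime-power (suc zero) = begin
    ρ k (p ^ 2)                                        ≡⟨ ρ-prime-power-rec 0 ⟩
    (ρ k p ∸ 1) * p ^ (1 * (k ∸ 1)) + p ^ k * ρ k 1     ≡⟨ cong₂ _+_ (*-comm (ρ k p ∸ 1) _) (cong (p ^ k *_) (ρ-1 k)) ⟩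
    p ^ (1 * (k ∸ 1)) * (ρ k p ∸ 1) + p ^ k * 1         ≡⟨ cong (p ^ (1 * (k ∸ 1)) * (ρ k p ∸ 1) +_)
                                                              (trans (*-identityʳ (p ^ k)) (cong (p ^_) (sym (*-identityʳ k)))) ⟩
    p ^ (1 * (k ∸ 1)) * (ρ k p ∸ 1) + p ^ (k * 1)       ∎
  ρ-prime-power (suc (suc s)) = begin
    ρ k (p ^ suc (suc (suc s)))
      ≡⟨ ρ-prime-power-rec (suc s) ⟩
    c * X + p ^ k * ρ k (p ^ suc s)
      ≡⟨ cong (λ r → c * X + p ^ k * r) (ρ-prime-power s) ⟩
    c * X + p ^ k * (Ω k p (suc s) (s / 2) * c + p ^ (k * (suc s / 2)))
      ≡⟨ solve 5 (λ c X K O Y → c :* X :+ K :* (O :* c :+ Y) := (X :+ K :* O) :* c :+ K :* Y) refl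
               c X (p ^ k) (Ω k p (suc s) (s / 2)) (p ^ (k * (suc s / 2))) ⟩
    (X + p ^ k * Ω k p (suc s) (s / 2)) * c + p ^ k * p ^ (k * (suc s / 2))
      ≡⟨ cong₂ _+_ (cong (_* c) (sym (Ω-shift k p (suc s) (s / 2)))) (sym (^-*-suc p k (suc s / 2))) ⟩
    Ω k p (suc (suc (suc s))) (suc (s / 2)) * c + p ^ (k * suc (suc s / 2))
      ≡⟨ cong₂ (λ a b → Ω k p (suc (suc (suc s))) a * c + p ^ (k * b)) (sym (half-suc-suc s)) (sym (half-suc-suc (suc s))) ⟩
    Ω k p (suc (suc (suc s))) (suc (suc s) / 2) * c + p ^ (k * (suc (suc (suc s)) / 2)) ∎
    where
    c = ρ k p ∸ 1
    X = p ^ (suc (suc s) * (k ∸ 1))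
    half-suc-suc : ∀ n → suc (suc n) / 2 ≡ suc (n / 2)
    half-suc-suc n = m/n≡1+[m∸n]/n {suc (suc n)} {2} (s≤s (s≤s z≤n))

corollary2 : (p s k : ℕ) → Prime p → p ≢ 2 → s ≥ 1 → k ≥ 1 →
    ρ₀ k (p ^ s) ≡ Ω k p s ((s ∸ 1) / 2) * (ρ₀ k p ∸ 1) + p ^ (k * (s / 2))
corollary2 p zero    k _       _   ()  _
corollary2 p (suc s) k p-prime p≢2 _ _ = begin
  ρ₀ k (p ^ suc s)                                               ≡⟨ ρ₀≡ρ k (p ^ suc s) ⟩
  ρ k (p ^ suc s)                                                ≡⟨ ρ-prime-power p-prime p≢2 k s ⟩
  Ω k p (suc s) (s / 2) * (ρ k p ∸ 1) + p ^ (k * (suc s / 2))    ≡⟨ cong (λ r → Ω k p (suc s) (s / 2) * (r ∸ 1) + p ^ (k * (suc s / 2)))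
                                                                       (sym (ρ₀≡ρ k p)) ⟩
  Ω k p (suc s) (s / 2) * (ρ₀ k p ∸ 1) + p ^ (k * (suc s / 2))   ∎
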